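{- Let $n\ge 1$, let $B=\mathbb{Z}[X_1,\ldots,X_n]/K$ with $K=(X_1^2-2X_1,\ldots,X_n^2-2X_n)$, and for $J\subseteq\{1,\ldots,n\}$ let $Y_J=\prod_{j\in J}X_j \bmod K$ (with $Y_\emptyset=1$). Let $f(X)=c_dX^d+\cdots+c_1X+c_0\in\mathbb{Z}[X]$. Then in $B$, \[f\Bigl(\sum_{i=1}^n Y_{\{i\}}\Bigr)=\sum_{p=0}^{n}\Bigl(\sum_{q=p}^{d}2^{q-p}\,p!\,S(q,p)\,c_q\Bigr)\sum_{J\subseteq\{1,\ldots,n\},\ |J|=p}Y_J,\] where an inner sum over $q$ with no terms (i.e. $p>d$) is $0$.
   Context: $S(q,p)$ denotes the Stirling number of the second kind, defined by $x^q=\sum_{p\ge 0}S(q,p)(x)_p$ with $(x)_p=x(x-1)\cdots(x-p+1)$, $(x)_0=1$; in particular $S(0,0)=1$ and $S(q,0)=0$ for $q>0$. -}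

module Defs where

open import Data.Nat as ℕ using (ℕ; zero; suc; _∸_; _^_; _≤ᵇ_)

open import Data.Integer as ℤ using (ℤ; +_)
open import Data.Fin using (Fin; toℕ)
open import Data.Bool using (Bool; true; false; if_then_else_)
open import Data.List using (List; []; _∷_; map; foldr; filter; allFin; upTo; concatMap)
open import Data.Vec using (Vec; []; _∷_)
open import Data.Fin.Subset using (Subset; ∣_∣; ⁅_⁆)
open import Data.Fin.Subset.Properties using (_∈?_)
open import Data.Nat.Properties using (_≟_)

S : ℕ → ℕ → ℕ
S zero    zero    = 1
S zero    (suc p) = 0
S (suc q) zero    = 0
S (suc q) (suc p) = suc p ℕ.* S q (suc p) ℕ.+ S q p

-- The ring B = ℤ[X_1,…,X_n]/(X_1²-2X_1,…,X_n²-2X_n), presented as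
-- commutative-ring terms in variables X_i (i : Fin n) with integer
-- constants, modulo the congruence generated by the commutative ring
-- axioms, the fact that constants form a copy of ℤ, and X_i·X_i = 2·X_i.

infixl 6 _⊕_
infixl 7 _⊗_
infix 4 _≈_

data Expr (n : ℕ) : Set where
  var : Fin n → Expr n
  con : ℤ → Expr n
  _⊕_ : Expr n → Expr n → Expr n
  _⊗_ : Expr n → Expr n → Expr n
  ⊝_  : Expr n → Expr n

data _≈_ {n : ℕ} : Expr n → Expr n → Set where
  ≈-refl  : ∀ {x} → x ≈ x
  ≈-sym   : ∀ {x y} → x ≈ y → y ≈ x
  ≈-trans : ∀ {x y z} → x ≈ y → y ≈ z → x ≈ z
  ⊕-cong  : ∀ {x x′ y y′} → x ≈ x′ → y ≈ y′ → x ⊕ y ≈ x′ ⊕ y′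
  ⊗-cong  : ∀ {x x′ y y′} → x ≈ x′ → y ≈ y′ → x ⊗ y ≈ x′ ⊗ y′
  ⊝-cong  : ∀ {x x′} → x ≈ x′ → ⊝ x ≈ ⊝ x′
  ⊕-assoc   : ∀ x y z → (x ⊕ y) ⊕ z ≈ x ⊕ (y ⊕ z)
  ⊕-comm    : ∀ x y → x ⊕ y ≈ y ⊕ x
  ⊕-identity : ∀ x → con (+ 0) ⊕ x ≈ x
  ⊝-inverse : ∀ x → (⊝ x) ⊕ x ≈ con (+ 0)
  ⊗-assoc   : ∀ x y z → (x ⊗ y) ⊗ z ≈ x ⊗ (y ⊗ z)
  ⊗-comm    : ∀ x y → x ⊗ y ≈ y ⊗ x
  ⊗-identity : ∀ x → con (+ 1) ⊗ x ≈ x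
  distrib   : ∀ x y z → x ⊗ (y ⊕ z) ≈ (x ⊗ y) ⊕ (x ⊗ z)
  con-+ : ∀ a b → con a ⊕ con b ≈ con (a ℤ.+ b)
  con-* : ∀ a b → con a ⊗ con b ≈ con (a ℤ.* b)
  rel   : ∀ i → var i ⊗ var i ≈ con (+ 2) ⊗ var i

sumE : ∀ {n} → List (Expr n) → Expr n
sumE = foldr _⊕_ (con (+ 0))

prodE : ∀ {n} → List (Expr n) → Expr n
prodE = foldr _⊗_ (con (+ 1))

powE : ∀ {n} → Expr n → ℕ → Expr n
powE x zero    = con (+ 1)
powE x (suc k) = x ⊗ powE x k

Y : ∀ {n} → Subset n → Expr n
Y {n} J = prodE (map var (filter (_∈? J) (allFin n)))

allSubsets : (n : ℕ) → List (Subset n)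
allSubsets zero    = [] ∷ []
allSubsets (suc n) = concatMap (λ J → (true ∷ J) ∷ (false ∷ J) ∷ []) (allSubsets n)

sumY : (n p : ℕ) → Expr n
sumY n p = sumE (map Y (filter (λ J → ∣ J ∣ ≟ p) (allSubsets n)))

sumSingletons : (n : ℕ) → Expr n
sumSingletons n = sumE (map (λ i → Y ⁅ i ⁆) (allFin n))

evalPoly : ∀ {n} (d : ℕ) → (Fin (suc d) → ℤ) → Expr n → Expr n
evalPoly d c x = sumE (map (λ q → con (c q) ⊗ powE x (toℕ q)) (allFin (suc d)))

sumℤ : List ℤ → ℤ
sumℤ = foldr ℤ._+_ (+ 0)

coeff : (d : ℕ) → (Fin (suc d) → ℤ) → ℕ → ℤ
coeff d c p = sumℤ (map (λ q → if p ≤ᵇ toℕ q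
                                 then (+ (2 ^ (toℕ q ∸ p) ℕ.* (p ℕ.!) ℕ.* S (toℕ q) p)) ℤ.* c q
                                 else + 0)
                        (allFin (suc d)))

rhs : (n d : ℕ) → (Fin (suc d) → ℤ) → Expr n
rhs n d c = sumE (map (λ p → con (coeff d c p) ⊗ sumY n p) (upTo (suc n)))

-- Write s = ∑ᵢ Xᵢ and E p = ∑_{|J| = p} Y_J. As Xᵢ² = 2 Xᵢ, multiplying Y_J by Xᵢ either
-- adds i to J or doubles Y_J, whence s · E p = (p + 1) · E (p + 1) + 2p · E p; formally this is
-- an induction on n splitting off X₀, with s = X₀ + s′ and E (p + 1) = X₀ E′ p + E′ (p + 1).
-- Hence s^q = ∑_p a(q,p) · E p, where a(0,p) = [p = 0] and
-- a(q+1,p+1) = (p+1) (a(q,p) + 2 a(q,p+1)), a recurrence solved by a(q,p) = 2^(q-p) p! S(q,p)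
-- thanks to the recurrence for S. Summing c_q s^q and exchanging the two sums gives the claim.

module Submission where

open import Defs
open import Data.Nat as ℕ using (ℕ; zero; suc; _≤_; _<_; _∸_; _^_; _!; _≤ᵇ_; s≤s)
import Data.Nat.Properties as ℕ
open import Data.Nat.Solver using (module +-*-Solver)
open import Data.Integer as ℤ using (ℤ; +_)
import Data.Integer.Properties as ℤ
open import Data.Fin using (Fin; zero; suc; toℕ; inject₁; fromℕ)
open import Data.Fin.Properties using (toℕ-inject₁; toℕ-fromℕ)
open import Data.Fin.Subset using (Subset; ∣_∣; ⁅_⁆; ⊥)
open import Data.Fin.Subset.Properties using (_∈?_)
open import Data.Bool using (Bool; true; false; T; if_then_else_)
open import Data.List using (List; []; _∷_; map; filter; tabulate; allFin; applyUpTo; concatMap)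
open import Data.List.Properties using (map-tabulate; map-upTo)
open import Data.Maybe using (Maybe; just; nothing)
open import Data.Product using (_,_)
open import Data.Vec using (_∷_)
open import Function using (_∘_; id)
open import Level using (0ℓ)
open import Algebra.Bundles using (CommutativeRing)
open import Algebra.Structures using (IsCommutativeRing)
open import Algebra.Solver.Ring.AlmostCommutativeRing
  using (fromCommutativeRing; _-Raw-AlmostCommutative⟶_)
open import Relation.Binary.Structures using (IsEquivalence)
import Relation.Binary.Reasoning.Setoid
import Algebra.Properties.Semiring.Sum
open import Relation.Nullary using (does; yes; no)
open import Relation.Binary.PropositionalEquality as ≡ using (_≡_; refl; cong; cong₂)

S-vanish : ∀ {q p} → q < p → S q p ≡ 0
S-vanish {zero}  {suc p} _ = refl
S-vanish {suc q} {suc p} (s≤s q<p)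
  rewrite S-vanish (ℕ.m<n⇒m<1+n q<p) | S-vanish q<p | ℕ.*-zeroʳ p = refl

powerCoeff : ℕ → ℕ → ℕ
powerCoeff q p = 2 ^ (q ∸ p) ℕ.* p ! ℕ.* S q p

powerCoeff-vanish : ∀ {q p} → q < p → powerCoeff q p ≡ 0
powerCoeff-vanish {q} {p} q<p =
  ≡.trans (cong (2 ^ (q ∸ p) ℕ.* p ! ℕ.*_) (S-vanish q<p)) (ℕ.*-zeroʳ (2 ^ (q ∸ p) ℕ.* p !))

powerCoeff-suc-zero : ∀ q → powerCoeff (suc q) 0 ≡ 0
powerCoeff-suc-zero q = ℕ.*-zeroʳ (2 ^ suc q ℕ.* 1)

m>n⇒m∸n≡1+[m∸1+n] : ∀ {m n} → n < m → m ∸ n ≡ suc (m ∸ suc n)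
m>n⇒m∸n≡1+[m∸1+n] {suc m} {zero}  _         = refl
m>n⇒m∸n≡1+[m∸1+n] {suc m} {suc n} (s≤s n<m) = m>n⇒m∸n≡1+[m∸1+n] n<m

2^[q∸p]*S[q,1+p] : ∀ q p → 2 ^ (q ∸ p) ℕ.* S q (suc p) ≡ 2 ℕ.* 2 ^ (q ∸ suc p) ℕ.* S q (suc p)
2^[q∸p]*S[q,1+p] q p with p ℕ.<? q
... | yes p<q = cong (λ e → 2 ^ e ℕ.* S q (suc p)) (m>n⇒m∸n≡1+[m∸1+n] p<q)
... | no  p≮q rewrite S-vanish {q} {suc p} (s≤s (ℕ.≮⇒≥ p≮q)) =
  ≡.trans (ℕ.*-zeroʳ (2 ^ (q ∸ p))) (≡.sym (ℕ.*-zeroʳ (2 ℕ.* 2 ^ (q ∸ suc p))))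

powerCoeff-suc : ∀ q p →
  powerCoeff (suc q) (suc p) ≡ suc p ℕ.* (powerCoeff q p ℕ.+ 2 ℕ.* powerCoeff q (suc p))
powerCoeff-suc q p = begin
  t ℕ.* (r ℕ.* f) ℕ.* (r ℕ.* k ℕ.+ m)
    ≡⟨ solve 5 (λ t r f k m → t :* (r :* f) :* (r :* k :+ m) := r :* (t :* f :* m) :+ r :* (r :* f :* (t :* k)))
               refl t r f k m ⟩
  r ℕ.* (t ℕ.* f ℕ.* m) ℕ.+ r ℕ.* (r ℕ.* f ℕ.* (t ℕ.* k))
    ≡⟨ cong (λ x → r ℕ.* (t ℕ.* f ℕ.* m) ℕ.+ r ℕ.* (r ℕ.* f ℕ.* x)) (2^[q∸p]*S[q,1+p] q p) ⟩
  r ℕ.* (t ℕ.* f ℕ.* m) ℕ.+ r ℕ.* (r ℕ.* f ℕ.* (2 ℕ.* u ℕ.* k))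
    ≡⟨ solve 6 (λ t u r f k m → r :* (t :* f :* m) :+ r :* (r :* f :* (con 2 :* u :* k))
                              := r :* (t :* f :* m :+ con 2 :* (u :* (r :* f) :* k)))
               refl t u r f k m ⟩
  r ℕ.* (t ℕ.* f ℕ.* m ℕ.+ 2 ℕ.* (u ℕ.* (r ℕ.* f) ℕ.* k)) ∎
  where
    open ≡.≡-Reasoning
    open +-*-Solver
    t = 2 ^ (q ∸ p)
    u = 2 ^ (q ∸ suc p)
    r = suc p
    f = p !
    k = S q (suc p)
    m = S q p

coeff-summand : ∀ (c : ℤ) q p →
  (if p ≤ᵇ q then + (2 ^ (q ∸ p) ℕ.* p ! ℕ.* S q p) ℤ.* c else + 0) ≡ + powerCoeff q p ℤ.* c
coeff-summand c q p with p ≤ᵇ q in p≤ᵇq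
... | true  = refl
... | false = cong (λ k → + k ℤ.* c) (≡.sym (powerCoeff-vanish {q} {p} q<p))
  where q<p = ℕ.≰⇒> (λ p≤q → ≡.subst T p≤ᵇq (ℕ.≤⇒≤ᵇ p≤q))

module _ {n : ℕ} where

  ≈-isEquivalence : IsEquivalence (_≈_ {n})
  ≈-isEquivalence = record { refl = ≈-refl ; sym = ≈-sym ; trans = ≈-trans }

  ≡⇒≈ : {x y : Expr n} → x ≡ y → x ≈ y
  ≡⇒≈ refl = ≈-refl

  ⊗-distribʳ : ∀ (x y z : Expr n) → (y ⊕ z) ⊗ x ≈ y ⊗ x ⊕ z ⊗ x
  ⊗-distribʳ x y z = ≈-trans (⊗-comm _ _) (≈-trans (distrib x y z) (⊕-cong (⊗-comm _ _) (⊗-comm _ _)))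

  isCommutativeRing : IsCommutativeRing (_≈_ {n}) _⊕_ _⊗_ ⊝_ (con (+ 0)) (con (+ 1))
  isCommutativeRing = record
    { isRing = record
      { +-isAbelianGroup = record
        { isGroup = record
          { isMonoid = record
            { isSemigroup = record
              { isMagma = record { isEquivalence = ≈-isEquivalence ; ∙-cong = ⊕-cong }
              ; assoc = ⊕-assoc }
            ; identity = ⊕-identity , λ x → ≈-trans (⊕-comm _ _) (⊕-identity x) }
          ; inverse = ⊝-inverse , λ x → ≈-trans (⊕-comm _ _) (⊝-inverse x)
          ; ⁻¹-cong = ⊝-cong }
        ; comm = ⊕-comm }
      ; *-cong = ⊗-cong
      ; *-assoc = ⊗-assoc
      ; *-identity = ⊗-identity , λ x → ≈-trans (⊗-comm _ _) (⊗-identity x)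
      ; distrib = distrib , ⊗-distribʳ }
    ; *-comm = ⊗-comm }

B : ℕ → CommutativeRing 0ℓ 0ℓ
B n = record { isCommutativeRing = isCommutativeRing {n} }

module _ {n : ℕ} where

  open import Algebra.Properties.Group (CommutativeRing.+-group (B n)) using (inverseˡ-unique)

  con-⊝ : ∀ a → con {n} (ℤ.- a) ≈ ⊝ con a
  con-⊝ a = inverseˡ-unique _ _ (≈-trans (con-+ _ _) (≡⇒≈ (cong con (ℤ.+-inverseˡ a))))

  con-morphism : CommutativeRing.rawRing ℤ.+-*-commutativeRing -Raw-AlmostCommutative⟶ fromCommutativeRing (B n)
  con-morphism = record
    { ⟦_⟧    = con
    ; +-homo = λ a b → ≈-sym (con-+ a b)
    ; *-homo = λ a b → ≈-sym (con-* a b)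
    ; -‿homo = con-⊝
    ; 0-homo = ≈-refl
    ; 1-homo = ≈-refl }

  con-≟ : ∀ a b → Maybe (con {n} a ≈ con b)
  con-≟ a b with a ℤ.≟ b
  ... | yes refl = just ≈-refl
  ... | no _     = nothing

  open import Algebra.Solver.Ring _ _ con-morphism con-≟ public using (solve; _:=_; _:+_; _:*_; con)

  con-+ℕ : ∀ k m → con {n} (+ (k ℕ.+ m)) ≈ con (+ k) ⊕ con (+ m)
  con-+ℕ k m = ≈-sym (con-+ (+ k) (+ m))

  con-*ℕ : ∀ k m → con {n} (+ (k ℕ.* m)) ≈ con (+ k) ⊗ con (+ m)
  con-*ℕ k m = ≈-trans (≡⇒≈ (cong con (ℤ.pos-* k m))) (≈-sym (con-* _ _))

module ≈-Reasoning {n : ℕ} = Relation.Binary.Reasoning.Setoid (CommutativeRing.setoid (B n))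
module Sum (n : ℕ) = Algebra.Properties.Semiring.Sum (CommutativeRing.semiring (B n))

shift : ∀ {n} → Expr n → Expr (suc n)
shift (var i) = var (suc i)
shift (con a) = con a
shift (x ⊕ y) = shift x ⊕ shift y
shift (x ⊗ y) = shift x ⊗ shift y
shift (⊝ x)   = ⊝ shift x

shift-cong : ∀ {n} {x y : Expr n} → x ≈ y → shift x ≈ shift y
shift-cong ≈-refl            = ≈-refl
shift-cong (≈-sym p)         = ≈-sym (shift-cong p)
shift-cong (≈-trans p q)     = ≈-trans (shift-cong p) (shift-cong q)
shift-cong (⊕-cong p q)      = ⊕-cong (shift-cong p) (shift-cong q)
shift-cong (⊗-cong p q)      = ⊗-cong (shift-cong p) (shift-cong q)
shift-cong (⊝-cong p)        = ⊝-cong (shift-cong p)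
shift-cong (⊕-assoc x y z)   = ⊕-assoc _ _ _
shift-cong (⊕-comm x y)      = ⊕-comm _ _
shift-cong (⊕-identity x)    = ⊕-identity _
shift-cong (⊝-inverse x)     = ⊝-inverse _
shift-cong (⊗-assoc x y z)   = ⊗-assoc _ _ _
shift-cong (⊗-comm x y)      = ⊗-comm _ _
shift-cong (⊗-identity x)    = ⊗-identity _
shift-cong (distrib x y z)   = distrib _ _ _
shift-cong (con-+ a b)       = con-+ a b
shift-cong (con-* a b)       = con-* a b
shift-cong (rel i)           = rel (suc i)

filter-∈?-tabulate-suc : ∀ {m n} b (J : Subset n) (f : Fin m → Fin n) →
  filter (_∈? (b ∷ J)) (tabulate (suc ∘ f)) ≡ map suc (filter (_∈? J) (tabulate f))
filter-∈?-tabulate-suc {zero}  b J f = refl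
filter-∈?-tabulate-suc {suc m} b J f with does (f zero ∈? J)
... | true  = cong (suc (f zero) ∷_) (filter-∈?-tabulate-suc b J (f ∘ suc))
... | false = filter-∈?-tabulate-suc b J (f ∘ suc)

prodE-map-var-suc : ∀ {n} (is : List (Fin n)) → prodE (map var (map suc is)) ≡ shift (prodE (map var is))
prodE-map-var-suc []       = refl
prodE-map-var-suc (i ∷ is) = cong (var (suc i) ⊗_) (prodE-map-var-suc is)

Y-outside : ∀ {n} (J : Subset n) → Y (false ∷ J) ≡ shift (Y J)
Y-outside {n} J = ≡.trans (cong (prodE ∘ map var) (filter-∈?-tabulate-suc false J id))
                          (prodE-map-var-suc (filter (_∈? J) (allFin n)))

Y-inside : ∀ {n} (J : Subset n) → Y (true ∷ J) ≡ var zero ⊗ shift (Y J)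
Y-inside {n} J = cong (var zero ⊗_) (≡.trans (cong (prodE ∘ map var) (filter-∈?-tabulate-suc true J id))
                                             (prodE-map-var-suc (filter (_∈? J) (allFin n))))

Y-⊥ : ∀ n → Y {n} ⊥ ≈ con (+ 1)
Y-⊥ zero    = ≈-refl
Y-⊥ (suc n) = ≈-trans (≡⇒≈ (Y-outside ⊥)) (shift-cong (Y-⊥ n))

sumYOfSize : ∀ {n} → ℕ → List (Subset n) → Expr n
sumYOfSize p Js = sumE (map Y (filter (λ J → ∣ J ∣ ℕ.≟ p) Js))

when : ∀ {n} → Bool → Expr n → Expr n
when b x = if b then x else con (+ 0)

sumYOfSize-∷ : ∀ {n} p (J : Subset n) Js →
  sumYOfSize p (J ∷ Js) ≈ when (does (∣ J ∣ ℕ.≟ p)) (Y J) ⊕ sumYOfSize p Js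
sumYOfSize-∷ p J Js with does (∣ J ∣ ℕ.≟ p)
... | true  = ≈-refl
... | false = ≈-sym (⊕-identity _)

when-shift : ∀ {n} b (x : Expr n) → when b (shift x) ≡ shift (when b x)
when-shift true  x = refl
when-shift false x = refl

when-var-zero : ∀ {n} b (x : Expr n) → when b (var zero ⊗ shift x) ≈ var zero ⊗ shift (when b x)
when-var-zero true  x = ≈-refl
when-var-zero false x = solve 1 (λ X → con (+ 0) := X :* con (+ 0)) ≈-refl (var zero)

extensions : ∀ {n} → Subset n → List (Subset (suc n))
extensions J = (true ∷ J) ∷ (false ∷ J) ∷ []

sumYOfSize-zero-extensions : ∀ {n} (Js : List (Subset n)) →
  sumYOfSize 0 (concatMap extensions Js) ≈ shift (sumYOfSize 0 Js)
sumYOfSize-zero-extensions [] = ≈-refl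
sumYOfSize-zero-extensions (J ∷ Js) = begin
  -- the filter discards true ∷ J by computation, its size being a successor
  sumYOfSize 0 ((false ∷ J) ∷ concatMap extensions Js)
    ≈⟨ sumYOfSize-∷ 0 (false ∷ J) _ ⟩
  when b (Y (false ∷ J)) ⊕ sumYOfSize 0 (concatMap extensions Js)
    ≈⟨ ⊕-cong (≡⇒≈ (≡.trans (cong (when b) (Y-outside J)) (when-shift b (Y J))))
              (sumYOfSize-zero-extensions Js) ⟩
  shift (when b (Y J) ⊕ sumYOfSize 0 Js)
    ≈⟨ shift-cong (sumYOfSize-∷ 0 J Js) ⟨
  shift (sumYOfSize 0 (J ∷ Js)) ∎
  where
    open ≈-Reasoning
    b = does (∣ J ∣ ℕ.≟ 0)

sumYOfSize-suc-extensions : ∀ {n} p (Js : List (Subset n)) →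
  sumYOfSize (suc p) (concatMap extensions Js)
    ≈ var zero ⊗ shift (sumYOfSize p Js) ⊕ shift (sumYOfSize (suc p) Js)
sumYOfSize-suc-extensions p [] = solve 1 (λ X → con (+ 0) := X :* con (+ 0) :+ con (+ 0)) ≈-refl (var zero)
sumYOfSize-suc-extensions p (J ∷ Js) = begin
  sumYOfSize (suc p) ((true ∷ J) ∷ (false ∷ J) ∷ concatMap extensions Js)
    ≈⟨ ≈-trans (sumYOfSize-∷ (suc p) (true ∷ J) _) (⊕-cong ≈-refl (sumYOfSize-∷ (suc p) (false ∷ J) _)) ⟩
  when b (Y (true ∷ J)) ⊕ (when b′ (Y (false ∷ J)) ⊕ sumYOfSize (suc p) (concatMap extensions Js))
    ≈⟨ ⊕-cong (≈-trans (≡⇒≈ (cong (when b) (Y-inside J))) (when-var-zero b (Y J)))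
              (⊕-cong (≡⇒≈ (≡.trans (cong (when b′) (Y-outside J)) (when-shift b′ (Y J))))
                      (sumYOfSize-suc-extensions p Js)) ⟩
  X ⊗ shift y ⊕ (shift y′ ⊕ (X ⊗ shift e ⊕ shift e′))
    ≈⟨ solve 5 (λ X y y′ e e′ → X :* y :+ (y′ :+ (X :* e :+ e′)) := X :* (y :+ e) :+ (y′ :+ e′))
               ≈-refl X (shift y) (shift y′) (shift e) (shift e′) ⟩
  X ⊗ shift (y ⊕ e) ⊕ shift (y′ ⊕ e′)
    ≈⟨ ⊕-cong (⊗-cong ≈-refl (shift-cong (sumYOfSize-∷ p J Js))) (shift-cong (sumYOfSize-∷ (suc p) J Js)) ⟨
  X ⊗ shift (sumYOfSize p (J ∷ Js)) ⊕ shift (sumYOfSize (suc p) (J ∷ Js)) ∎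
  where
    open ≈-Reasoning
    X  = var zero
    b  = does (∣ J ∣ ℕ.≟ p)
    b′ = does (∣ J ∣ ℕ.≟ suc p)
    y  = when b (Y J)
    y′ = when b′ (Y J)
    e  = sumYOfSize p Js
    e′ = sumYOfSize (suc p) Js

sumY-suc-zero : ∀ n → sumY (suc n) 0 ≈ shift (sumY n 0)
sumY-suc-zero n = sumYOfSize-zero-extensions (allSubsets n)

sumY-suc-suc : ∀ n p → sumY (suc n) (suc p) ≈ var zero ⊗ shift (sumY n p) ⊕ shift (sumY n (suc p))
sumY-suc-suc n p = sumYOfSize-suc-extensions p (allSubsets n)

sumY-zero : ∀ n → sumY n 0 ≈ con (+ 1)
sumY-zero zero    = ≈-trans (⊕-comm _ _) (⊕-identity _)
sumY-zero (suc n) = ≈-trans (sumY-suc-zero n) (shift-cong (sumY-zero n))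

sumY-vanish : ∀ {n p} → n < p → sumY n p ≈ con (+ 0)
sumY-vanish {zero}  {suc p} _ = ≈-refl
sumY-vanish {suc n} {suc p} (s≤s n<p) = begin
  sumY (suc n) (suc p)
    ≈⟨ sumY-suc-suc n p ⟩
  var zero ⊗ shift (sumY n p) ⊕ shift (sumY n (suc p))
    ≈⟨ ⊕-cong (⊗-cong ≈-refl (shift-cong (sumY-vanish n<p))) (shift-cong (sumY-vanish (ℕ.m<n⇒m<1+n n<p))) ⟩
  var zero ⊗ con (+ 0) ⊕ con (+ 0)
    ≈⟨ solve 1 (λ X → X :* con (+ 0) :+ con (+ 0) := con (+ 0)) ≈-refl (var zero) ⟩
  con (+ 0) ∎
  where open ≈-Reasoning

sumE-singletons-suc : ∀ {m n} (f : Fin m → Fin n) →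
  sumE (map (λ i → Y ⁅ i ⁆) (tabulate (suc ∘ f))) ≡ shift (sumE (map (λ i → Y ⁅ i ⁆) (tabulate f)))
sumE-singletons-suc {zero}  f = refl
sumE-singletons-suc {suc m} f = cong₂ _⊕_ (Y-outside ⁅ f zero ⁆) (sumE-singletons-suc (f ∘ suc))

sumSingletons-suc : ∀ n → sumSingletons (suc n) ≈ var zero ⊕ shift (sumSingletons n)
sumSingletons-suc n = ⊕-cong Y⁅zero⁆ (≡⇒≈ (sumE-singletons-suc id))
  where
    Y⁅zero⁆ : Y {suc n} ⁅ zero ⁆ ≈ var zero
    Y⁅zero⁆ = ≈-trans (≡⇒≈ (Y-inside ⊥))
                (≈-trans (⊗-cong ≈-refl (shift-cong (Y-⊥ n)))
                         (solve 1 (λ X → X :* con (+ 1) := X) ≈-refl (var zero)))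

sumSingletons-*-sumY : ∀ n p →
  sumSingletons n ⊗ sumY n p ≈ con (+ suc p) ⊗ sumY n (suc p) ⊕ con (+ 2) ⊗ con (+ p) ⊗ sumY n p
sumSingletons-*-sumY zero zero =
  solve 0 (con (+ 0) :* (con (+ 1) :+ con (+ 0))
           := con (+ 1) :* con (+ 0) :+ con (+ 2) :* con (+ 0) :* (con (+ 1) :+ con (+ 0))) ≈-refl
sumSingletons-*-sumY zero (suc p) =
  solve 2 (λ a b → con (+ 0) :* con (+ 0) := a :* con (+ 0) :+ con (+ 2) :* b :* con (+ 0))
          ≈-refl (con (+ suc (suc p))) (con (+ suc p))
sumSingletons-*-sumY (suc n) zero = begin
  sumSingletons (suc n) ⊗ sumY (suc n) 0
    ≈⟨ ⊗-cong (sumSingletons-suc n) (sumY-suc-zero n) ⟩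
  (X ⊕ t) ⊗ e₀
    ≈⟨ ⊗-distribʳ e₀ X t ⟩
  X ⊗ e₀ ⊕ t ⊗ e₀
    ≈⟨ ⊕-cong ≈-refl (shift-cong (sumSingletons-*-sumY n 0)) ⟩
  X ⊗ e₀ ⊕ (con (+ 1) ⊗ e₁ ⊕ con (+ 2) ⊗ con (+ 0) ⊗ e₀)
    ≈⟨ solve 3 (λ X e₀ e₁ → X :* e₀ :+ (con (+ 1) :* e₁ :+ con (+ 2) :* con (+ 0) :* e₀)
                          := con (+ 1) :* (X :* e₀ :+ e₁) :+ con (+ 2) :* con (+ 0) :* e₀) ≈-refl X e₀ e₁ ⟩
  con (+ 1) ⊗ (X ⊗ e₀ ⊕ e₁) ⊕ con (+ 2) ⊗ con (+ 0) ⊗ e₀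
    ≈⟨ ⊕-cong (⊗-cong ≈-refl (sumY-suc-suc n 0)) (⊗-cong ≈-refl (sumY-suc-zero n)) ⟨
  con (+ 1) ⊗ sumY (suc n) 1 ⊕ con (+ 2) ⊗ con (+ 0) ⊗ sumY (suc n) 0 ∎
  where
    open ≈-Reasoning
    X  = var zero
    t  = shift (sumSingletons n)
    e₀ = shift (sumY n 0)
    e₁ = shift (sumY n 1)
sumSingletons-*-sumY (suc n) (suc q) = begin
  sumSingletons (suc n) ⊗ sumY (suc n) (suc q)
    ≈⟨ ⊗-cong (sumSingletons-suc n) (sumY-suc-suc n q) ⟩
  (X ⊕ t) ⊗ (X ⊗ a ⊕ b)
    ≈⟨ solve 4 (λ X t a b → (X :+ t) :* (X :* a :+ b) := (X :* X) :* a :+ X :* (t :* a) :+ X :* b :+ t :* b)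
               ≈-refl X t a b ⟩
  (X ⊗ X) ⊗ a ⊕ X ⊗ (t ⊗ a) ⊕ X ⊗ b ⊕ t ⊗ b
    ≈⟨ ⊕-cong (⊕-cong (⊕-cong (⊗-cong (rel zero) ≈-refl)
                               (⊗-cong ≈-refl (shift-cong (sumSingletons-*-sumY n q)))) ≈-refl)
              (shift-cong (sumSingletons-*-sumY n (suc q))) ⟩
  (con (+ 2) ⊗ X) ⊗ a ⊕ X ⊗ (Q₁ ⊗ b ⊕ con (+ 2) ⊗ Q ⊗ a) ⊕ X ⊗ b ⊕ (Q₂ ⊗ c ⊕ con (+ 2) ⊗ Q₁ ⊗ b)
    ≈⟨ solve 7 (λ X a b c Q Q₁ Q₂ →
          (con (+ 2) :* X) :* a :+ X :* (Q₁ :* b :+ con (+ 2) :* Q :* a) :+ X :* b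
            :+ (Q₂ :* c :+ con (+ 2) :* Q₁ :* b)
          := con (+ 2) :* (con (+ 1) :+ Q) :* (X :* a) :+ (con (+ 1) :+ Q₁) :* (X :* b)
            :+ Q₂ :* c :+ con (+ 2) :* Q₁ :* b)
          ≈-refl X a b c Q Q₁ Q₂ ⟩
  con (+ 2) ⊗ (con (+ 1) ⊕ Q) ⊗ (X ⊗ a) ⊕ (con (+ 1) ⊕ Q₁) ⊗ (X ⊗ b) ⊕ Q₂ ⊗ c ⊕ con (+ 2) ⊗ Q₁ ⊗ b
    ≈⟨ ⊕-cong (⊕-cong (⊕-cong (⊗-cong (⊗-cong ≈-refl (con-+ (+ 1) (+ q))) ≈-refl)
                               (⊗-cong (con-+ (+ 1) (+ suc q)) ≈-refl)) ≈-refl) ≈-refl ⟩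
  con (+ 2) ⊗ Q₁ ⊗ (X ⊗ a) ⊕ Q₂ ⊗ (X ⊗ b) ⊕ Q₂ ⊗ c ⊕ con (+ 2) ⊗ Q₁ ⊗ b
    ≈⟨ solve 6 (λ X a b c Q₁ Q₂ →
          con (+ 2) :* Q₁ :* (X :* a) :+ Q₂ :* (X :* b) :+ Q₂ :* c :+ con (+ 2) :* Q₁ :* b
          := Q₂ :* (X :* b :+ c) :+ con (+ 2) :* Q₁ :* (X :* a :+ b))
          ≈-refl X a b c Q₁ Q₂ ⟩
  Q₂ ⊗ (X ⊗ b ⊕ c) ⊕ con (+ 2) ⊗ Q₁ ⊗ (X ⊗ a ⊕ b)
    ≈⟨ ⊕-cong (⊗-cong ≈-refl (sumY-suc-suc n (suc q))) (⊗-cong ≈-refl (sumY-suc-suc n q)) ⟨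
  Q₂ ⊗ sumY (suc n) (suc (suc q)) ⊕ con (+ 2) ⊗ Q₁ ⊗ sumY (suc n) (suc q) ∎
  where
    open ≈-Reasoning
    X  = var zero
    t  = shift (sumSingletons n)
    a  = shift (sumY n q)
    b  = shift (sumY n (suc q))
    c  = shift (sumY n (suc (suc q)))
    Q  = con (+ q)
    Q₁ = con (+ suc q)
    Q₂ = con (+ suc (suc q))

module _ {n : ℕ} where
  open Sum n

  ∑-shift : ∀ N (h : ℕ → Expr n) → h 0 ≈ con (+ 0) → h N ≈ con (+ 0) →
    ∑[ i < N ] h (suc (toℕ i)) ≈ ∑[ i < N ] h (toℕ i)
  ∑-shift N h h0≈0 hN≈0 = begin
    ∑[ i < N ] h (suc (toℕ i))
      ≈⟨ ⊕-identity _ ⟨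
    con (+ 0) ⊕ ∑[ i < N ] h (suc (toℕ i))
      ≈⟨ ⊕-cong h0≈0 ≈-refl ⟨
    ∑[ i < suc N ] h (toℕ i)
      ≈⟨ sum-init-last (h ∘ toℕ) ⟩
    ∑[ i < N ] h (toℕ (inject₁ i)) ⊕ h (toℕ (fromℕ N))
      ≈⟨ ⊕-cong (sum-cong-≋ (λ (i : Fin N) → ≡⇒≈ (cong h (toℕ-inject₁ i))))
                (≈-trans (≡⇒≈ (cong h (toℕ-fromℕ N))) hN≈0) ⟩
    ∑[ i < N ] h (toℕ i) ⊕ con (+ 0)
      ≈⟨ ≈-trans (⊕-comm _ _) (⊕-identity _) ⟩
    ∑[ i < N ] h (toℕ i) ∎
    where open ≈-Reasoning

  sumYCombination : (ℕ → Expr n) → Expr n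
  sumYCombination c = ∑[ p ≤ n ] (c (toℕ p) ⊗ sumY n (toℕ p))

  timesSumSingletons : (ℕ → Expr n) → ℕ → Expr n
  timesSumSingletons c zero    = con (+ 0)
  timesSumSingletons c (suc p) = con (+ suc p) ⊗ (c p ⊕ con (+ 2) ⊗ c (suc p))

  sumSingletons-*-sumYCombination : ∀ (c : ℕ → Expr n) →
    sumSingletons n ⊗ sumYCombination c ≈ sumYCombination (timesSumSingletons c)
  sumSingletons-*-sumYCombination c = begin
    s ⊗ ∑[ p ≤ n ] (c (toℕ p) ⊗ E (toℕ p))
      ≈⟨ *-distribˡ-sum {suc n} s (λ p → c (toℕ p) ⊗ E (toℕ p)) ⟩
    ∑[ p ≤ n ] (s ⊗ (c (toℕ p) ⊗ E (toℕ p)))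
      ≈⟨ sum-cong-≋ {suc n} (λ p → split (toℕ p)) ⟩
    ∑[ p ≤ n ] (raise (suc (toℕ p)) ⊕ keep (toℕ p))
      ≈⟨ ∑-distrib-+ {suc n} (raise ∘ suc ∘ toℕ) (keep ∘ toℕ) ⟩
    ∑[ p ≤ n ] raise (suc (toℕ p)) ⊕ ∑[ p ≤ n ] keep (toℕ p)
      ≈⟨ ⊕-cong (∑-shift (suc n) raise ≈-refl raise-top) ≈-refl ⟩
    ∑[ p ≤ n ] raise (toℕ p) ⊕ ∑[ p ≤ n ] keep (toℕ p)
      ≈⟨ ∑-distrib-+ {suc n} (raise ∘ toℕ) (keep ∘ toℕ) ⟨
    ∑[ p ≤ n ] (raise (toℕ p) ⊕ keep (toℕ p))
      ≈⟨ sum-cong-≋ {suc n} (λ p → merge (toℕ p)) ⟩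
    ∑[ p ≤ n ] (timesSumSingletons c (toℕ p) ⊗ E (toℕ p)) ∎
    where
      open ≈-Reasoning
      s = sumSingletons n
      E = sumY n
      raise : ℕ → Expr n
      raise zero    = con (+ 0)
      raise (suc p) = con (+ suc p) ⊗ c p ⊗ E (suc p)
      keep : ℕ → Expr n
      keep p = con (+ 2) ⊗ con (+ p) ⊗ c p ⊗ E p
      split : ∀ p → s ⊗ (c p ⊗ E p) ≈ raise (suc p) ⊕ keep p
      split p = ≈-trans (solve 3 (λ s x e → s :* (x :* e) := x :* (s :* e)) ≈-refl s (c p) (E p))
        (≈-trans (⊗-cong ≈-refl (sumSingletons-*-sumY n p))
          (solve 5 (λ x a e′ b e → x :* (a :* e′ :+ con (+ 2) :* b :* e)
                                   := a :* x :* e′ :+ con (+ 2) :* b :* x :* e)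
                 ≈-refl (c p) (con (+ suc p)) (E (suc p)) (con (+ p)) (E p)))
      raise-top : raise (suc n) ≈ con (+ 0)
      raise-top = ≈-trans (⊗-cong ≈-refl (sumY-vanish (ℕ.n<1+n n)))
                          (solve 2 (λ a x → a :* x :* con (+ 0) := con (+ 0)) ≈-refl (con (+ suc n)) (c n))
      merge : ∀ p → raise p ⊕ keep p ≈ timesSumSingletons c p ⊗ E p
      merge zero    = solve 2 (λ x e → con (+ 0) :+ con (+ 2) :* con (+ 0) :* x :* e := con (+ 0) :* e)
                            ≈-refl (c 0) (E 0)
      merge (suc p) = solve 4 (λ a x y e → a :* x :* e :+ con (+ 2) :* a :* y :* e
                                           := a :* (x :+ con (+ 2) :* y) :* e)
                            ≈-refl (con (+ suc p)) (c p) (c (suc p)) (E (suc p))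

  sumYCombination-cong : ∀ {c c′ : ℕ → Expr n} → (∀ p → c p ≈ c′ p) → sumYCombination c ≈ sumYCombination c′
  sumYCombination-cong c≈c′ = sum-cong-≋ {suc n} (λ p → ⊗-cong (c≈c′ (toℕ p)) (≈-refl {x = sumY n (toℕ p)}))

  timesSumSingletons-powerCoeff : ∀ q p →
    timesSumSingletons (λ p → con (+ powerCoeff q p)) p ≈ con (+ powerCoeff (suc q) p)
  timesSumSingletons-powerCoeff q zero    = ≡⇒≈ (cong (λ k → con (+ k)) (≡.sym (powerCoeff-suc-zero q)))
  timesSumSingletons-powerCoeff q (suc p) = begin
    con (+ suc p) ⊗ (con (+ a) ⊕ con (+ 2) ⊗ con (+ b))
      ≈⟨ ⊗-cong ≈-refl (⊕-cong ≈-refl (con-*ℕ 2 b)) ⟨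
    con (+ suc p) ⊗ (con (+ a) ⊕ con (+ (2 ℕ.* b)))
      ≈⟨ ⊗-cong ≈-refl (con-+ℕ a (2 ℕ.* b)) ⟨
    con (+ suc p) ⊗ con (+ (a ℕ.+ 2 ℕ.* b))
      ≈⟨ con-*ℕ (suc p) _ ⟨
    con (+ (suc p ℕ.* (a ℕ.+ 2 ℕ.* b)))
      ≡⟨ cong (λ k → con (+ k)) (powerCoeff-suc q p) ⟨
    con (+ powerCoeff (suc q) (suc p)) ∎
    where
      open ≈-Reasoning
      a = powerCoeff q p
      b = powerCoeff q (suc p)

  powE-sumSingletons : ∀ q → powE (sumSingletons n) q ≈ sumYCombination (λ p → con (+ powerCoeff q p))
  powE-sumSingletons zero = begin
    con (+ 1)
      ≈⟨ solve 0 (con (+ 1) := con (+ 1) :* con (+ 1) :+ con (+ 0)) ≈-refl ⟩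
    con (+ 1) ⊗ con (+ 1) ⊕ con (+ 0)
      ≈⟨ ⊕-cong (⊗-cong ≈-refl (sumY-zero n)) (≈-trans (sum-cong-≋ {n} higher-vanish) (sum-replicate-zero n)) ⟨
    sumYCombination (λ p → con (+ powerCoeff 0 p)) ∎
    where
      open ≈-Reasoning
      higher-vanish : ∀ (p : Fin n) → con (+ powerCoeff 0 (suc (toℕ p))) ⊗ sumY n (suc (toℕ p)) ≈ con (+ 0)
      higher-vanish p =
        ≈-trans (⊗-cong (≡⇒≈ (cong (λ k → con (+ k)) (powerCoeff-vanish {p = suc (toℕ p)} (s≤s ℕ.z≤n)))) ≈-refl)
                (solve 1 (λ e → con (+ 0) :* e := con (+ 0)) ≈-refl (sumY n (suc (toℕ p))))
  powE-sumSingletons (suc q) = begin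
    sumSingletons n ⊗ powE (sumSingletons n) q
      ≈⟨ ⊗-cong ≈-refl (powE-sumSingletons q) ⟩
    sumSingletons n ⊗ sumYCombination (λ p → con (+ powerCoeff q p))
      ≈⟨ sumSingletons-*-sumYCombination (λ p → con (+ powerCoeff q p)) ⟩
    sumYCombination (timesSumSingletons (λ p → con (+ powerCoeff q p)))
      ≈⟨ sumYCombination-cong (timesSumSingletons-powerCoeff q) ⟩
    sumYCombination (λ p → con (+ powerCoeff (suc q) p)) ∎
    where open ≈-Reasoning

  sumE-map-tabulate : ∀ {m k} (g : Fin k → Expr n) (f : Fin m → Fin k) →
    sumE (map g (tabulate f)) ≡ ∑[ i < m ] g (f i)
  sumE-map-tabulate {zero}  g f = refl
  sumE-map-tabulate {suc m} g f = cong (g (f zero) ⊕_) (sumE-map-tabulate g (f ∘ suc))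

  sumE-applyUpTo : ∀ m (f : ℕ → Expr n) → sumE (applyUpTo f m) ≡ ∑[ i < m ] f (toℕ i)
  sumE-applyUpTo zero    f = refl
  sumE-applyUpTo (suc m) f = cong (f 0 ⊕_) (sumE-applyUpTo m (f ∘ suc))

  con-sumℤ-map-tabulate : ∀ {m k} (g : Fin k → ℤ) (f : Fin m → Fin k) →
    con (sumℤ (map g (tabulate f))) ≈ ∑[ i < m ] con (g (f i))
  con-sumℤ-map-tabulate {zero}  g f = ≈-refl
  con-sumℤ-map-tabulate {suc m} g f =
    ≈-trans (≈-sym (con-+ _ _)) (⊕-cong ≈-refl (con-sumℤ-map-tabulate g (f ∘ suc)))

  con-coeff-⊗ : ∀ d (c : Fin (suc d) → ℤ) p (e : Expr n) →
    con (coeff d c p) ⊗ e ≈ ∑[ q ≤ d ] (con (c q) ⊗ (con (+ powerCoeff (toℕ q) p) ⊗ e))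
  con-coeff-⊗ d c p e = begin
    con (coeff d c p) ⊗ e
      ≈⟨ ⊗-cong (con-sumℤ-map-tabulate summand id) ≈-refl ⟩
    ∑[ q ≤ d ] con (summand q) ⊗ e
      ≡⟨ cong (_⊗ e) (sum-cong-≗ (λ q → cong con (coeff-summand (c q) (toℕ q) p))) ⟩
    ∑[ q ≤ d ] con (+ powerCoeff (toℕ q) p ℤ.* c q) ⊗ e
      ≈⟨ *-distribʳ-sum e (λ q → con (+ powerCoeff (toℕ q) p ℤ.* c q)) ⟩
    ∑[ q ≤ d ] (con (+ powerCoeff (toℕ q) p ℤ.* c q) ⊗ e)
      ≈⟨ sum-cong-≋ {suc d} (λ q → ≈-trans (⊗-cong (≈-sym (con-* _ _)) ≈-refl)
                 (solve 3 (λ a x e → (a :* x) :* e := x :* (a :* e))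
                          ≈-refl (con (+ powerCoeff (toℕ q) p)) (con (c q)) e)) ⟩
    ∑[ q ≤ d ] (con (c q) ⊗ (con (+ powerCoeff (toℕ q) p) ⊗ e)) ∎
    where
      open ≈-Reasoning
      summand : Fin (suc d) → ℤ
      summand q = if p ≤ᵇ toℕ q then + (2 ^ (toℕ q ∸ p) ℕ.* p ! ℕ.* S (toℕ q) p) ℤ.* c q else + 0

mainTheorem2 : (n : ℕ) → 1 ≤ n → (d : ℕ) → (c : Fin (suc d) → ℤ) →
    evalPoly d c (sumSingletons n) ≈ rhs n d c
mainTheorem2 n _ d c = begin
  evalPoly d c s
    ≡⟨ sumE-map-tabulate (λ q → con (c q) ⊗ powE s (toℕ q)) id ⟩
  ∑[ q ≤ d ] (con (c q) ⊗ powE s (toℕ q))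
    ≈⟨ sum-cong-≋ {suc d} (λ q → ⊗-cong (≈-refl {x = con (c q)}) (powE-sumSingletons (toℕ q))) ⟩
  ∑[ q ≤ d ] (con (c q) ⊗ ∑[ p ≤ n ] (a (toℕ q) (toℕ p) ⊗ E (toℕ p)))
    ≈⟨ sum-cong-≋ {suc d} (λ q → *-distribˡ-sum {suc n} (con (c q)) (λ p → a (toℕ q) (toℕ p) ⊗ E (toℕ p))) ⟩
  ∑[ q ≤ d ] ∑[ p ≤ n ] (con (c q) ⊗ (a (toℕ q) (toℕ p) ⊗ E (toℕ p)))
    ≈⟨ ∑-comm {suc d} {suc n} (λ q p → con (c q) ⊗ (a (toℕ q) (toℕ p) ⊗ E (toℕ p))) ⟩
  ∑[ p ≤ n ] ∑[ q ≤ d ] (con (c q) ⊗ (a (toℕ q) (toℕ p) ⊗ E (toℕ p)))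
    ≈⟨ sum-cong-≋ {suc n} (λ p → con-coeff-⊗ d c (toℕ p) (E (toℕ p))) ⟨
  ∑[ p ≤ n ] (con (coeff d c (toℕ p)) ⊗ E (toℕ p))
    ≡⟨ ≡.trans (cong sumE (map-upTo summand (suc n))) (sumE-applyUpTo (suc n) summand) ⟨
  rhs n d c ∎
  where
    open ≈-Reasoning
    open Sum n
    s = sumSingletons n
    E = sumY n
    a : ℕ → ℕ → Expr n
    a q p = con (+ powerCoeff q p)
    summand : ℕ → Expr n
    summand p = con (coeff d c p) ⊗ E p
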